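{- Let $u$ be a positive integer. If there exists a $\left(4u,\ 2u-\sqrt{5u-1},\ u+1-\sqrt{5u-1}\right)$ cyclic difference set, then $u=B_i^2+1$ for some integer $i\ge1$, where the integers $A_i,B_i$ are defined by $\left(\frac{3+\sqrt5}{2}\right)^i=\frac{A_i+\sqrt5\,B_i}{2}$.
   Context: An $(n,k,\lambda)$ cyclic difference set is a $k$-subset $D$ of a cyclic group $G$ of order $n$ such that every non-identity element $g\in G$ has exactly $\lambda$ representations $g=xy^{ -1}$ with $x,y\in D$. -}

module Defs where

open import Data.Nat as ℕ using (ℕ; _+_; _≟_)
open import Data.Integer as ℤ using (ℤ; +_)
open import Data.Fin using (Fin; toℕ)
open import Data.Fin.Subset using (Subset; _∈_; ∣_∣)
open import Data.Fin.Subset.Properties using (_∈?_)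
open import Data.List using (List; length; filter; cartesianProduct; allFin)
open import Data.Product using (_×_; _,_)
open import Data.Sum using (_⊎_)
open import Relation.Nullary using (¬_; Dec)
open import Relation.Nullary.Decidable using (_×-dec_; _⊎-dec_)
open import Relation.Binary.PropositionalEquality using (_≡_)

-- The cyclic group of order n is modelled as Fin n = {0,…,n-1} under
-- addition modulo n.
DiffIs : ∀ {n} → Fin n → Fin n → Fin n → Set
DiffIs {n} x y g = (toℕ x ≡ toℕ y + toℕ g) ⊎ (toℕ x + n ≡ toℕ y + toℕ g)

diffIs? : ∀ {n} (x y g : Fin n) → Dec (DiffIs x y g)
diffIs? {n} x y g = (toℕ x ≟ toℕ y + toℕ g) ⊎-dec (toℕ x + n ≟ toℕ y + toℕ g)

reps : ∀ {n} → Subset n → Fin n → ℕ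
reps {n} D g =
  length (filter (λ p → let x = Data.Product.proj₁ p ; y = Data.Product.proj₂ p
                        in (x ∈? D) ×-dec ((y ∈? D) ×-dec diffIs? x y g))
                 (cartesianProduct (allFin n) (allFin n)))

IsCyclicDifferenceSet : (n k l : ℕ) → Subset n → Set
IsCyclicDifferenceSet n k l D =
  (∣ D ∣ ≡ k) × (∀ (g : Fin n) → ¬ (toℕ g ≡ 0) → reps D g ≡ l)

-- ℤ[√5]: a pair (a , b) stands for a + b√5
ℤ√5 : Set
ℤ√5 = ℤ × ℤ

_·_ : ℤ√5 → ℤ√5 → ℤ√5
(a , b) · (c , d) = (a ℤ.* c ℤ.+ + 5 ℤ.* (b ℤ.* d) , a ℤ.* d ℤ.+ b ℤ.* c)

_^√_ : ℤ√5 → ℕ → ℤ√5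
x ^√ ℕ.zero = (+ 1 , + 0)
x ^√ ℕ.suc i = x · (x ^√ i)

-- IsAB i A B  :⇔  ((3+√5)/2)^i = (A + √5 B)/2,
-- written without fractions as  2^i (A + √5 B) = 2 (3+√5)^i  in ℤ[√5]
-- (equality of coefficient pairs, since √5 is irrational).
IsAB : ℕ → ℤ → ℤ → Set
IsAB i A B =
  ((+ (2 ℕ.^ i)) ℤ.* A , (+ (2 ℕ.^ i)) ℤ.* B)
    ≡ (+ 2 , + 0) · ((+ 3 , + 1) ^√ i)

module Submission where

-- In ℤ/2mℤ (here m = 2u) the parity of x − y is that of x + y, so
-- the ordered pairs of D with odd difference are exactly those of mixed parity.
-- If D has e even and o odd elements, counting these pairs in two ways gives
-- 2eo = mλ (each of the m odd elements is a difference exactly λ times), while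
-- e + o = k.  Hence k² − 4uλ = (e − o)² is a square c², and eliminating k, λ via
-- the parameter relations gives u = c² + 1; the hypothesis k ≥ 1 excludes c = 0.
--
-- Then s² = 5c² + 4, i.e. (s + c√5)/2 is a unit of norm 1.  Dividing
-- by the unit (3 + √5)/2 gives a smaller solution (s′ , c′), so by descent on c
-- every solution is ((3 + √5)/2)^i, i.e. (s , c) = (A_i , B_i), with i ≥ 1 as c ≥ 1.

open import Defs
open import Data.Nat using (ℕ; zero; suc; _+_; _*_; _∸_; _^_; _≤_; _<_; _≤?_; z≤n; s≤s; z<s)
open import Data.Nat.Properties
open import Data.Nat.Divisibility using (_∣_; quotient; ∣m+n∣m⇒∣n; m∣m*n)
open import Data.Nat.Primality using (euclidsLemma; prime[2])
open import Data.Nat.Induction using (<-rec)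
open import Data.Nat.Tactic.RingSolver using (solve; solve-∀)
import Data.Nat.ListAction as List
open import Data.Nat.ListAction.Properties using (sum-++)
open import Data.Integer as ℤ using (ℤ; +_)
import Data.Integer.Properties as ℤ
import Data.Integer.Tactic.RingSolver as ℤ-Ring
open import Data.Bool using (if_then_else_; true; false)
open import Data.Fin as Fin using (Fin; toℕ; fromℕ<; punchIn)
open import Data.Fin.Properties using (toℕ<n; toℕ-injective; toℕ-fromℕ<; punchInᵢ≢i)
open import Data.Fin.Subset using (Subset; ∣_∣; inside; outside)
open import Data.Fin.Subset.Properties using (_∈?_)
open import Data.List as L using (List; []; _∷_; length; filter; cartesianProduct; allFin; tabulate; _++_)
open import Data.List.Properties using (map-++; map-∘)
import Data.Vec as Vec
open import Data.Product using (_×_; _,_; proj₁; proj₂; ∃₂; ∃-syntax; Σ-syntax)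
open import Data.Sum using (inj₁; inj₂; reduce)
open import Data.Empty using (⊥; ⊥-elim)
open import Function using (_∘_; id)
open import Relation.Nullary using (Dec; yes; no; does; ¬_; contradiction)
open import Relation.Nullary.Decidable using (_×-dec_)
open import Relation.Unary using (Pred; Decidable)
open import Relation.Binary.PropositionalEquality
open import Algebra.Properties.Semiring.Sum +-*-semiring
  using (sum; sum-syntax; sum-cong-≗; sum-remove; sum-replicate-zero; ∑-comm; ∑-distrib-+;
         *-distribˡ-sum; *-distribʳ-sum)

𝟙 : ∀ {p} {P : Set p} → Dec P → ℕ
𝟙 d = if does d then 1 else 0

𝟙-yes : ∀ {p} {P : Set p} (d : Dec P) → P → 𝟙 d ≡ 1
𝟙-yes (yes _) _ = refl
𝟙-yes (no ¬p) p = contradiction p ¬p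

𝟙-no : ∀ {p} {P : Set p} (d : Dec P) → ¬ P → 𝟙 d ≡ 0
𝟙-no (yes p) ¬p = contradiction p ¬p
𝟙-no (no _) _ = refl

𝟙-× : ∀ {p q} {P : Set p} {Q : Set q} (p? : Dec P) (q? : Dec Q) → 𝟙 (p? ×-dec q?) ≡ 𝟙 p? * 𝟙 q?
𝟙-× (yes _) q? = sym (+-identityʳ (𝟙 q?))
𝟙-× (no _) q? = refl

length-filter≡sum : ∀ {a p} {A : Set a} {P : Pred A p} (P? : Decidable P) (xs : List A) →
                    length (filter P? xs) ≡ List.sum (L.map (𝟙 ∘ P?) xs)
length-filter≡sum P? [] = refl
length-filter≡sum P? (x ∷ xs) with does (P? x)
... | true = cong suc (length-filter≡sum P? xs)
... | false = length-filter≡sum P? xs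

sum-cartesianProduct : ∀ {a b} {A : Set a} {B : Set b} (f : A × B → ℕ) (xs : List A) (ys : List B) →
  List.sum (L.map f (cartesianProduct xs ys))
    ≡ List.sum (L.map (λ x → List.sum (L.map (λ y → f (x , y)) ys)) xs)
sum-cartesianProduct f [] ys = refl
sum-cartesianProduct f (x ∷ xs) ys = begin
  List.sum (L.map f (L.map (x ,_) ys ++ cartesianProduct xs ys))
    ≡⟨ cong List.sum (map-++ f (L.map (x ,_) ys) _) ⟩
  List.sum (L.map f (L.map (x ,_) ys) ++ L.map f (cartesianProduct xs ys))
    ≡⟨ sum-++ (L.map f (L.map (x ,_) ys)) _ ⟩
  List.sum (L.map f (L.map (x ,_) ys)) + List.sum (L.map f (cartesianProduct xs ys))
    ≡⟨ cong₂ _+_ (cong List.sum (sym (map-∘ ys))) (sum-cartesianProduct f xs ys) ⟩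
  List.sum (L.map (λ y → f (x , y)) ys)
    + List.sum (L.map (λ x → List.sum (L.map (λ y → f (x , y)) ys)) xs) ∎
  where open ≡-Reasoning

sum-tabulate : ∀ {n a} {A : Set a} (f : A → ℕ) (g : Fin n → A) →
               List.sum (L.map f (tabulate g)) ≡ ∑[ i < n ] f (g i)
sum-tabulate {zero} f g = refl
sum-tabulate {suc n} f g = cong (_+_ (f (g Fin.zero))) (sum-tabulate f (g ∘ Fin.suc))

reps-as-sum : ∀ {n} (D : Subset n) (g : Fin n) →
  reps D g ≡ ∑[ x < n ] ∑[ y < n ] (𝟙 (x ∈? D) * (𝟙 (y ∈? D) * 𝟙 (diffIs? x y g)))
reps-as-sum {n} D g = begin
  reps D g
    ≡⟨ length-filter≡sum P? (cartesianProduct (allFin n) (allFin n)) ⟩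
  List.sum (L.map (𝟙 ∘ P?) (cartesianProduct (allFin n) (allFin n)))
    ≡⟨ sum-cartesianProduct (𝟙 ∘ P?) (allFin n) (allFin n) ⟩
  List.sum (L.map (λ x → List.sum (L.map (λ y → 𝟙 (P? (x , y))) (allFin n))) (allFin n))
    ≡⟨ sum-tabulate (λ x → List.sum (L.map (λ y → 𝟙 (P? (x , y))) (allFin n))) id ⟩
  ∑[ x < n ] List.sum (L.map (λ y → 𝟙 (P? (x , y))) (allFin n))
    ≡⟨ sum-cong-≗ (λ x → sum-tabulate (λ y → 𝟙 (P? (x , y))) id) ⟩
  ∑[ x < n ] ∑[ y < n ] 𝟙 (P? (x , y))
    ≡⟨ sum-cong-≗ (λ x → sum-cong-≗ (λ y →
         trans (𝟙-× (x ∈? D) ((y ∈? D) ×-dec diffIs? x y g))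
               (cong (𝟙 (x ∈? D) *_) (𝟙-× (y ∈? D) (diffIs? x y g))))) ⟩
  ∑[ x < n ] ∑[ y < n ] (𝟙 (x ∈? D) * (𝟙 (y ∈? D) * 𝟙 (diffIs? x y g))) ∎
  where
  open ≡-Reasoning
  P? : (p : Fin n × Fin n) → Dec _
  P? (x , y) = (x ∈? D) ×-dec ((y ∈? D) ×-dec diffIs? x y g)

∣∣-as-sum : ∀ {n} (D : Subset n) → ∣ D ∣ ≡ ∑[ x < n ] 𝟙 (x ∈? D)
∣∣-as-sum Vec.[] = refl
∣∣-as-sum (inside Vec.∷ D) = cong suc (∣∣-as-sum D)
∣∣-as-sum (outside Vec.∷ D) = ∣∣-as-sum D

∑-point : ∀ {n p} {P : Pred (Fin n) p} (P? : Decidable P) (f : Fin n → ℕ) {g₀ : Fin n} →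
          P g₀ → (∀ {g} → P g → g ≡ g₀) → ∑[ g < n ] (f g * 𝟙 (P? g)) ≡ f g₀
∑-point {suc n} P? f {g₀} Pg₀ unique = begin
  ∑[ g < suc n ] (f g * 𝟙 (P? g))                  ≡⟨ sum-remove {i = g₀} (λ g → f g * 𝟙 (P? g)) ⟩
  f g₀ * 𝟙 (P? g₀) + ∑[ j < n ] (f (punchIn g₀ j) * 𝟙 (P? (punchIn g₀ j)))
    ≡⟨ cong₂ _+_ (cong (f g₀ *_) (𝟙-yes (P? g₀) Pg₀)) (sum-cong-≗ elsewhere) ⟩
  f g₀ * 1 + ∑[ j < n ] 0                         ≡⟨ cong₂ _+_ (*-identityʳ (f g₀)) (sum-replicate-zero n) ⟩
  f g₀ + 0                                        ≡⟨ +-identityʳ (f g₀) ⟩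
  f g₀                                            ∎
  where
  open ≡-Reasoning
  elsewhere : ∀ j → f (punchIn g₀ j) * 𝟙 (P? (punchIn g₀ j)) ≡ 0
  elsewhere j = trans (cong (f (punchIn g₀ j) *_) (𝟙-no (P? (punchIn g₀ j)) (punchInᵢ≢i g₀ j ∘ unique)))
                      (*-zeroʳ (f (punchIn g₀ j)))

difference : ∀ {n} (x y : Fin n) → ∃[ g ] DiffIs x y g
difference {n} x y with toℕ y ≤? toℕ x
... | yes y≤x with m≤n⇒∃[o]m+o≡n y≤x
...   | t , y+t≡x = fromℕ< t<n , inj₁ (trans (sym y+t≡x) (cong (_+_ (toℕ y)) (sym (toℕ-fromℕ< t<n))))
  where
  t<n : t < n
  t<n = ≤-<-trans (m≤n+m t (toℕ y)) (subst (_< n) (sym y+t≡x) (toℕ<n x))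
difference {n} x y | no y≰x with m≤n⇒∃[o]m+o≡n (≤-trans (<⇒≤ (toℕ<n y)) (m≤n+m n (toℕ x)))
...   | t , y+t≡x+n = fromℕ< t<n , inj₂ (trans (sym y+t≡x+n) (cong (_+_ (toℕ y)) (sym (toℕ-fromℕ< t<n))))
  where
  t<n : t < n
  t<n = +-cancelˡ-< (toℕ y) t n (subst (_< toℕ y + n) (sym y+t≡x+n) (+-monoˡ-< n (≰⇒> y≰x)))

no-wraparound : ∀ {n x y g h : ℕ} → x ≡ y + g → x + n ≡ y + h → h < n → ⊥
no-wraparound {n} {x} {y} {g} {h} x≡y+g x+n≡y+h h<n = <⇒≱ h<n (begin
  n       ≤⟨ m≤n+m n g ⟩
  g + n   ≡⟨ +-cancelˡ-≡ y _ _ (begin-equality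
    y + (g + n) ≡⟨ +-assoc y g n ⟨
    y + g + n   ≡⟨ cong (_+ n) x≡y+g ⟨
    x + n       ≡⟨ x+n≡y+h ⟩
    y + h       ∎) ⟩
  h       ∎)
  where open ≤-Reasoning

difference-unique : ∀ {n} {x y g h : Fin n} → DiffIs x y g → DiffIs x y h → g ≡ h
difference-unique {y = y} (inj₁ e) (inj₁ e′) = toℕ-injective (+-cancelˡ-≡ (toℕ y) _ _ (trans (sym e) e′))
difference-unique {y = y} (inj₂ e) (inj₂ e′) = toℕ-injective (+-cancelˡ-≡ (toℕ y) _ _ (trans (sym e) e′))
difference-unique {h = h} (inj₁ e) (inj₂ e′) = ⊥-elim (no-wraparound e e′ (toℕ<n h))
difference-unique {g = g} (inj₂ e) (inj₁ e′) = ⊥-elim (no-wraparound e′ e (toℕ<n g))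

∑-difference : ∀ {n} (f : Fin n → ℕ) (x y : Fin n) →
               ∑[ g < n ] (f g * 𝟙 (diffIs? x y g)) ≡ f (proj₁ (difference x y))
∑-difference f x y = ∑-point (diffIs? x y) f (proj₂ (difference x y))
                             (λ d → difference-unique d (proj₂ (difference x y)))

isOdd isEven : ℕ → ℕ
isOdd zero = 0
isOdd (suc n) = isEven n
isEven zero = 1
isEven (suc n) = isOdd n

isEven+isOdd : ∀ n → isEven n + isOdd n ≡ 1
isEven+isOdd zero = refl
isEven+isOdd (suc zero) = refl
isEven+isOdd (suc (suc n)) = isEven+isOdd n

isOdd-+ : ∀ a b → isOdd (a + b) ≡ isOdd a * isEven b + isEven a * isOdd b
isEven-+ : ∀ a b → isEven (a + b) ≡ isEven a * isEven b + isOdd a * isOdd b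
isOdd-+ zero b = sym (+-identityʳ (isOdd b))
isOdd-+ (suc a) b = isEven-+ a b
isEven-+ zero b = sym (trans (+-identityʳ _) (+-identityʳ (isEven b)))
isEven-+ (suc a) b = isOdd-+ a b

isOdd-double : ∀ b a → isOdd (b + (b + a)) ≡ isOdd a
isOdd-double zero a = refl
isOdd-double (suc b) a rewrite +-suc b (b + a) = isOdd-double b a

∑-isOdd : ∀ m → ∑[ g < m + m ] isOdd (toℕ g) ≡ m
∑-isOdd zero = refl
∑-isOdd (suc m) rewrite +-suc m m = cong suc (∑-isOdd m)

isOdd-difference : ∀ {x y g} → x ≡ y + g → isOdd g ≡ isOdd (x + y)
isOdd-difference {y = y} {g} refl = begin
  isOdd g             ≡⟨ isOdd-double y g ⟨
  isOdd (y + (y + g)) ≡⟨ cong isOdd (+-comm y (y + g)) ⟩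
  isOdd (y + g + y)   ∎
  where open ≡-Reasoning

isOdd-wrapped-difference : ∀ {m x y g} → x + (m + m) ≡ y + g → isOdd g ≡ isOdd (x + y)
isOdd-wrapped-difference {m} {x} {y} {g} x+2m≡y+g = begin
  isOdd g                   ≡⟨ isOdd-difference x+2m≡y+g ⟩
  isOdd (x + (m + m) + y)   ≡⟨ cong isOdd (rearrange x m y) ⟩
  isOdd (m + (m + (x + y))) ≡⟨ isOdd-double m (x + y) ⟩
  isOdd (x + y)             ∎
  where
  open ≡-Reasoning
  rearrange : ∀ x m y → x + (m + m) + y ≡ m + (m + (x + y))
  rearrange = solve-∀

difference-parity : ∀ {m} {x y g : Fin (m + m)} → DiffIs x y g →
                    isOdd (toℕ g) ≡ isOdd (toℕ x + toℕ y)
difference-parity {x = x} {y} {g} (inj₁ x≡y+g) = isOdd-difference {toℕ x} {toℕ y} {toℕ g} x≡y+g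
difference-parity {m} {x} {y} {g} (inj₂ x+2m≡y+g) =
  isOdd-wrapped-difference {m} {toℕ x} {toℕ y} {toℕ g} x+2m≡y+g

∑-weighted-reorder : ∀ {k m n} (w : Fin k → ℕ) (F : Fin m → Fin n → Fin k → ℕ) →
  ∑[ g < k ] (w g * ∑[ x < m ] ∑[ y < n ] F x y g) ≡ ∑[ x < m ] ∑[ y < n ] ∑[ g < k ] (w g * F x y g)
∑-weighted-reorder {k} {m} {n} w F = begin
  ∑[ g < k ] (w g * ∑[ x < m ] ∑[ y < n ] F x y g)
    ≡⟨ sum-cong-≗ (λ g → trans (*-distribˡ-sum (w g) (λ x → ∑[ y < n ] F x y g))
                              (sum-cong-≗ (λ x → *-distribˡ-sum (w g) (λ y → F x y g)))) ⟩
  ∑[ g < k ] ∑[ x < m ] ∑[ y < n ] (w g * F x y g)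
    ≡⟨ ∑-comm (λ g x → ∑[ y < n ] (w g * F x y g)) ⟩
  ∑[ x < m ] ∑[ g < k ] ∑[ y < n ] (w g * F x y g)
    ≡⟨ sum-cong-≗ (λ x → ∑-comm (λ g y → w g * F x y g)) ⟩
  ∑[ x < m ] ∑[ y < n ] ∑[ g < k ] (w g * F x y g) ∎
  where open ≡-Reasoning

∑-product : ∀ {m n} (a : Fin m → ℕ) (b : Fin n → ℕ) →
            ∑[ x < m ] ∑[ y < n ] (a x * b y) ≡ (∑[ x < m ] a x) * (∑[ y < n ] b y)
∑-product a b = trans (sum-cong-≗ (λ x → sym (*-distribˡ-sum (a x) b))) (sym (*-distribʳ-sum (sum b) a))

evens odds : ∀ {n} → Subset n → ℕ
evens {n} D = ∑[ x < n ] (𝟙 (x ∈? D) * isEven (toℕ x))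
odds {n} D = ∑[ x < n ] (𝟙 (x ∈? D) * isOdd (toℕ x))

evens+odds : ∀ {n} (D : Subset n) → evens D + odds D ≡ ∣ D ∣
evens+odds {n} D = begin
  evens D + odds D
    ≡⟨ ∑-distrib-+ (λ x → χ x * isEven (toℕ x)) (λ x → χ x * isOdd (toℕ x)) ⟨
  ∑[ x < n ] (χ x * isEven (toℕ x) + χ x * isOdd (toℕ x))
    ≡⟨ sum-cong-≗ (λ x → trans (sym (*-distribˡ-+ (χ x) (isEven (toℕ x)) (isOdd (toℕ x))))
                              (trans (cong (χ x *_) (isEven+isOdd (toℕ x))) (*-identityʳ (χ x)))) ⟩
  ∑[ x < n ] χ x
    ≡⟨ ∣∣-as-sum D ⟨
  ∣ D ∣ ∎
  where
  open ≡-Reasoning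
  χ : Fin n → ℕ
  χ x = 𝟙 (x ∈? D)

-- Counting ordered pairs of D with odd difference: x − y is odd exactly when
-- one of x , y is even and the other odd, so there are 2 · evens D · odds D of them.
odd-differences : ∀ m (D : Subset (m + m)) →
  ∑[ g < m + m ] (isOdd (toℕ g) * reps D g) ≡ 2 * (evens D * odds D)
odd-differences m D = begin
  ∑[ g < m + m ] (w g * reps D g)
    ≡⟨ sum-cong-≗ (λ g → cong (w g *_) (reps-as-sum D g)) ⟩
  ∑[ g < m + m ] (w g * ∑[ x < m + m ] ∑[ y < m + m ] (χ x * (χ y * δ x y g)))
    ≡⟨ ∑-weighted-reorder w (λ x y g → χ x * (χ y * δ x y g)) ⟩
  ∑[ x < m + m ] ∑[ y < m + m ] ∑[ g < m + m ] (w g * (χ x * (χ y * δ x y g)))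
    ≡⟨ sum-cong-≗ (λ x → sum-cong-≗ (λ y → pair x y)) ⟩
  ∑[ x < m + m ] ∑[ y < m + m ] (o x * e y + e x * o y)
    ≡⟨ sum-cong-≗ (λ x → ∑-distrib-+ (λ y → o x * e y) (λ y → e x * o y)) ⟩
  ∑[ x < m + m ] (∑[ y < m + m ] (o x * e y) + ∑[ y < m + m ] (e x * o y))
    ≡⟨ ∑-distrib-+ (λ x → ∑[ y < m + m ] (o x * e y)) (λ x → ∑[ y < m + m ] (e x * o y)) ⟩
  ∑[ x < m + m ] ∑[ y < m + m ] (o x * e y) + ∑[ x < m + m ] ∑[ y < m + m ] (e x * o y)
    ≡⟨ cong₂ _+_ (∑-product o e) (∑-product e o) ⟩
  odds D * evens D + evens D * odds D
    ≡⟨ cong₂ _+_ (*-comm (odds D) (evens D)) (sym (+-identityʳ (evens D * odds D))) ⟩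
  2 * (evens D * odds D) ∎
  where
  open ≡-Reasoning
  w : Fin (m + m) → ℕ
  w g = isOdd (toℕ g)
  χ e o : Fin (m + m) → ℕ
  χ x = 𝟙 (x ∈? D)
  e x = χ x * isEven (toℕ x)
  o x = χ x * isOdd (toℕ x)
  δ : Fin (m + m) → Fin (m + m) → Fin (m + m) → ℕ
  δ x y g = 𝟙 (diffIs? x y g)
  regroup : ∀ a b c d → c * (a * (b * d)) ≡ a * (b * (c * d))
  regroup = solve-∀
  expand : ∀ a b ox ex oy ey → a * (b * (ox * ey + ex * oy)) ≡ a * ox * (b * ey) + a * ex * (b * oy)
  expand = solve-∀
  pair : ∀ x y → ∑[ g < m + m ] (w g * (χ x * (χ y * δ x y g))) ≡ o x * e y + e x * o y
  pair x y = begin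
    ∑[ g < m + m ] (w g * (χ x * (χ y * δ x y g)))
      ≡⟨ sum-cong-≗ (λ g → regroup (χ x) (χ y) (w g) (δ x y g)) ⟩
    ∑[ g < m + m ] (χ x * (χ y * (w g * δ x y g)))
      ≡⟨ trans (cong (χ x *_) (*-distribˡ-sum (χ y) (λ g → w g * δ x y g)))
               (*-distribˡ-sum (χ x) (λ g → χ y * (w g * δ x y g))) ⟨
    χ x * (χ y * ∑[ g < m + m ] (w g * δ x y g))
      ≡⟨ cong (λ t → χ x * (χ y * t)) (∑-difference w x y) ⟩
    χ x * (χ y * w (proj₁ (difference x y)))
      ≡⟨ cong (λ t → χ x * (χ y * t)) (difference-parity {m} (proj₂ (difference x y))) ⟩
    χ x * (χ y * isOdd (toℕ x + toℕ y))
      ≡⟨ cong (λ t → χ x * (χ y * t)) (isOdd-+ (toℕ x) (toℕ y)) ⟩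
    χ x * (χ y * (isOdd (toℕ x) * isEven (toℕ y) + isEven (toℕ x) * isOdd (toℕ y)))
      ≡⟨ expand (χ x) (χ y) (isOdd (toℕ x)) (isEven (toℕ x)) (isOdd (toℕ y)) (isEven (toℕ y)) ⟩
    o x * e y + e x * o y ∎

-- Counting them instead through the difference-set property: each of the m odd
-- elements of ℤ/2mℤ is non-zero and so has exactly λ representations.
odd-differences-λ : ∀ m {k l} {D : Subset (m + m)} → IsCyclicDifferenceSet (m + m) k l D →
  ∑[ g < m + m ] (isOdd (toℕ g) * reps D g) ≡ m * l
odd-differences-λ m {l = l} {D} (_ , reps≡l) = begin
  ∑[ g < m + m ] (isOdd (toℕ g) * reps D g) ≡⟨ sum-cong-≗ (λ g → odd⇒λ (toℕ g) (reps≡l g)) ⟩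
  ∑[ g < m + m ] (isOdd (toℕ g) * l)        ≡⟨ *-distribʳ-sum {m + m} l (λ g → isOdd (toℕ g)) ⟨
  (∑[ g < m + m ] isOdd (toℕ g)) * l        ≡⟨ cong (_* l) (∑-isOdd m) ⟩
  m * l                                     ∎
  where
  open ≡-Reasoning
  odd⇒λ : ∀ t {r} → (¬ t ≡ 0 → r ≡ l) → isOdd t * r ≡ isOdd t * l
  odd⇒λ zero _ = refl
  odd⇒λ (suc t) r≡l = cong (isOdd (suc t) *_) (r≡l (λ ()))

even-odd-balance : ∀ m {k l} {D : Subset (m + m)} → IsCyclicDifferenceSet (m + m) k l D →
  evens D + odds D ≡ k × 2 * (evens D * odds D) ≡ m * l
even-odd-balance m {D = D} isDS@(∣D∣≡k , _) =
  trans (evens+odds D) ∣D∣≡k , trans (sym (odd-differences m D)) (odd-differences-λ m isDS)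

square-cancel-≤ : ∀ {m n} → m * m ≤ n * n → m ≤ n
square-cancel-≤ m²≤n² = ≮⇒≥ (λ n<m → <⇒≱ (*-mono-< n<m n<m) m²≤n²)

square-cancel-< : ∀ {m n} → m * m < n * n → m < n
square-cancel-< m²<n² = ≰⇒> (λ n≤m → <⇒≱ m²<n² (*-mono-≤ n≤m n≤m))

square-root-unique : ∀ {m n} → m * m ≡ n * n → m ≡ n
square-root-unique m²≡n² =
  ≤-antisym (square-cancel-≤ (≤-reflexive m²≡n²)) (square-cancel-≤ (≤-reflexive (sym m²≡n²)))

square-gap : ∀ e o → ∃[ c ] c * c + 2 * (2 * (e * o)) ≡ (e + o) * (e + o)
square-gap e o with ≤-total e o
... | inj₁ e≤o with m≤n⇒∃[o]m+o≡n e≤o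
...   | d , refl = d , solve (e ∷ d ∷ [])
square-gap e o | inj₂ o≤e with m≤n⇒∃[o]m+o≡n o≤e
...   | d , refl = d , solve (o ∷ d ∷ [])

-- For a (2m, k, λ) cyclic difference set, k² − 2mλ = (e − o)² is a perfect square.
square-relation : ∀ m {k l} {D : Subset (m + m)} → IsCyclicDifferenceSet (m + m) k l D →
                  ∃[ c ] c * c + 2 * (m * l) ≡ k * k
square-relation m {D = D} isDS with even-odd-balance m isDS | square-gap (evens D) (odds D)
... | e+o≡k , 2eo≡mλ | c , gap =
  c , trans (cong (λ t → c * c + 2 * t) (sym 2eo≡mλ)) (trans gap (cong (λ t → t * t) e+o≡k))

parameters⇒square : ∀ {u s k l c} → s * s + 1 ≡ 5 * u → k + s ≡ 2 * u → l + s ≡ u + 1 →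
                    c * c + 2 * (2 * u * l) ≡ k * k → c * c + 1 ≡ u
parameters⇒square {u} {s} {k} {l} {c} s²+1≡5u k+s≡2u l+s≡u+1 c²+4uλ≡k² =
  +-cancelʳ-≡ (4 * u) _ _ (begin
    c * c + 1 + 4 * u ≡⟨ solve (c ∷ u ∷ []) ⟩
    c * c + 4 * u + 1 ≡⟨ cong (_+ 1) c²+4u≡s² ⟩
    s * s + 1         ≡⟨ s²+1≡5u ⟩
    5 * u             ≡⟨ solve (u ∷ []) ⟩
    u + 4 * u         ∎)
  where
  open ≡-Reasoning
  c²+4u≡s² : c * c + 4 * u ≡ s * s
  c²+4u≡s² = +-cancelʳ-≡ (4 * (u * u)) _ _ (begin
    c * c + 4 * u + 4 * (u * u)       ≡⟨ solve (c ∷ u ∷ []) ⟩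
    c * c + 4 * (u * (u + 1))         ≡⟨ cong (λ t → c * c + 4 * (u * t)) l+s≡u+1 ⟨
    c * c + 4 * (u * (l + s))         ≡⟨ solve (c ∷ u ∷ l ∷ s ∷ []) ⟩
    c * c + 2 * (2 * u * l) + 4 * (u * s) ≡⟨ cong (_+ 4 * (u * s)) c²+4uλ≡k² ⟩
    k * k + 4 * (u * s)               ≡⟨ solve (k ∷ u ∷ s ∷ []) ⟩
    k * k + 2 * s * (2 * u)           ≡⟨ cong (λ t → k * k + 2 * s * t) k+s≡2u ⟨
    k * k + 2 * s * (k + s)           ≡⟨ solve (k ∷ s ∷ []) ⟩
    (k + s) * (k + s) + s * s         ≡⟨ cong (λ t → t * t + s * s) k+s≡2u ⟩
    2 * u * (2 * u) + s * s           ≡⟨ solve (u ∷ s ∷ []) ⟩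
    s * s + 4 * (u * u)               ∎)

u≡1⇒k≡0 : ∀ {u s k} → s * s + 1 ≡ 5 * u → k + s ≡ 2 * u → u ≡ 1 → k ≡ 0
u≡1⇒k≡0 {s = s} {k} s²+1≡5 k+s≡2 refl
  with square-root-unique {s} {2} (+-cancelʳ-≡ 1 (s * s) 4 s²+1≡5)
... | refl = +-cancelʳ-≡ 2 k 0 k+s≡2

-- s² = 5c² + 4, i.e. (s + c√5)/2 is a unit of norm 1 in ℤ[(1+√5)/2].
Norm4 : ℕ → ℕ → Set
Norm4 s c = s * s ≡ 5 * (c * c) + 4

-- Step s′ c′ s c: (s′ + c′√5)/2 · (3 + √5)/2 = (s + c√5)/2, cleared of denominators.
Step : ℕ → ℕ → ℕ → ℕ → Set
Step s′ c′ s c = (2 * s ≡ 3 * s′ + 5 * c′) × (2 * c ≡ s′ + 3 * c′)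

Step-preserves-Norm4 : ∀ {s′ c′ s c} → Step s′ c′ s c → Norm4 s c → Norm4 s′ c′
Step-preserves-Norm4 {s′} {c′} {s} {c} (2s≡ , 2c≡) norm =
  *-cancelˡ-≡ _ _ 4 (+-cancelʳ-≡ _ _ _ expanded)
  where
  open ≡-Reasoning
  expanded : 4 * (s′ * s′) + 5 * ((s′ + c′) * (s′ + 5 * c′))
           ≡ 4 * (5 * (c′ * c′) + 4) + 5 * ((s′ + c′) * (s′ + 5 * c′))
  expanded = begin
    4 * (s′ * s′) + 5 * ((s′ + c′) * (s′ + 5 * c′))  ≡⟨ solve (s′ ∷ c′ ∷ []) ⟩
    (3 * s′ + 5 * c′) * (3 * s′ + 5 * c′)   ≡⟨ cong (λ t → t * t) 2s≡ ⟨
    (2 * s) * (2 * s)                       ≡⟨ solve (s ∷ []) ⟩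
    4 * (s * s)                             ≡⟨ cong (4 *_) norm ⟩
    4 * (5 * (c * c) + 4)                   ≡⟨ solve (c ∷ []) ⟩
    5 * ((2 * c) * (2 * c)) + 16            ≡⟨ cong (λ t → 5 * (t * t) + 16) 2c≡ ⟩
    5 * ((s′ + 3 * c′) * (s′ + 3 * c′)) + 16 ≡⟨ solve (s′ ∷ c′ ∷ []) ⟩
    4 * (5 * (c′ * c′) + 4) + 5 * ((s′ + c′) * (s′ + 5 * c′)) ∎

Norm4-upper : ∀ {s c} → 1 ≤ c → Norm4 s c → s ≤ 3 * c
Norm4-upper {s} {c} c≥1 norm = square-cancel-≤ (begin
  s * s                     ≡⟨ norm ⟩
  5 * (c * c) + 4           ≤⟨ +-monoʳ-≤ (5 * (c * c)) (*-monoʳ-≤ 4 (*-mono-≤ c≥1 c≥1)) ⟩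
  5 * (c * c) + 4 * (c * c) ≡⟨ solve (c ∷ []) ⟩
  (3 * c) * (3 * c)         ∎)
  where open ≤-Reasoning

Norm4-lower : ∀ {s c} → Norm4 s c → 5 * c ≤ 3 * s
Norm4-lower {s} {c} norm = square-cancel-≤ (begin
  (5 * c) * (5 * c)                      ≤⟨ m≤m+n ((5 * c) * (5 * c)) (20 * (c * c) + 36) ⟩
  (5 * c) * (5 * c) + (20 * (c * c) + 36) ≡⟨ solve (c ∷ []) ⟩
  9 * (5 * (c * c) + 4)                  ≡⟨ cong (9 *_) norm ⟨
  9 * (s * s)                            ≡⟨ solve (s ∷ []) ⟩
  (3 * s) * (3 * s)                      ∎)
  where open ≤-Reasoning

Norm4-gap : ∀ {s c} → Norm4 s c → c < s
Norm4-gap {s} {c} norm = square-cancel-< (begin-strict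
  c * c           ≤⟨ m≤n*m (c * c) 5 ⟩
  5 * (c * c)     <⟨ m<m+n (5 * (c * c)) z<s ⟩
  5 * (c * c) + 4 ≡⟨ norm ⟨
  s * s           ∎)
  where open ≤-Reasoning

-- If s + d = 3c then d² + 2ds = 9c² − s² = 4c² − 4, so d² is even and hence, 2 being
-- prime, so is d.
Norm4-parity : ∀ {s c d} → s + d ≡ 3 * c → Norm4 s c → 2 ∣ d
Norm4-parity {s} {c} {d} s+d≡3c norm = reduce (euclidsLemma d d prime[2] 2∣d²)
  where
  open ≡-Reasoning
  identity : 2 * (d * s + 2) + d * d ≡ 2 * (2 * (c * c))
  identity = +-cancelʳ-≡ (5 * (c * c)) _ _ (begin
    2 * (d * s + 2) + d * d + 5 * (c * c) ≡⟨ solve (d ∷ s ∷ c ∷ []) ⟩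
    d * d + 2 * (d * s) + (5 * (c * c) + 4) ≡⟨ cong (_+_ (d * d + 2 * (d * s))) norm ⟨
    d * d + 2 * (d * s) + s * s           ≡⟨ solve (d ∷ s ∷ []) ⟩
    (s + d) * (s + d)                     ≡⟨ cong (λ t → t * t) s+d≡3c ⟩
    (3 * c) * (3 * c)                     ≡⟨ solve (c ∷ []) ⟩
    2 * (2 * (c * c)) + 5 * (c * c)       ∎)
  2∣d² : 2 ∣ d * d
  2∣d² = ∣m+n∣m⇒∣n (subst (2 ∣_) (sym identity) (m∣m*n (2 * (c * c)))) (m∣m*n (d * s + 2))

-- The linear-arithmetic core of the descent: s + 2c′ = 3c and 3c′ + s′ = 2c
-- define the preceding solution, which is smaller because c < s.
step-down-bound : ∀ {s c c′} → s + c′ * 2 ≡ 3 * c → 5 * c ≤ 3 * s → 3 * c′ ≤ 2 * c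
step-down-bound {s} {c} {c′} s+2c′≡3c 5c≤3s = *-cancelˡ-≤ 2 (+-cancelʳ-≤ (5 * c) _ _ (begin
  2 * (3 * c′) + 5 * c ≤⟨ +-monoʳ-≤ (2 * (3 * c′)) 5c≤3s ⟩
  2 * (3 * c′) + 3 * s ≡⟨ solve (c′ ∷ s ∷ []) ⟩
  3 * (s + c′ * 2)     ≡⟨ cong (3 *_) s+2c′≡3c ⟩
  3 * (3 * c)          ≡⟨ solve (c ∷ []) ⟩
  2 * (2 * c) + 5 * c  ∎))
  where open ≤-Reasoning

step-down : ∀ {s c s′ c′} → s + c′ * 2 ≡ 3 * c → 3 * c′ + s′ ≡ 2 * c → c < s →
            Step s′ c′ s c × c′ < c
step-down {s} {c} {s′} {c′} s+2c′≡3c 3c′+s′≡2c c<s = (2s≡ , 2c≡) , c′<c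
  where
  2c≡ : 2 * c ≡ s′ + 3 * c′
  2c≡ = trans (sym 3c′+s′≡2c) (+-comm (3 * c′) s′)
  2s≡ : 2 * s ≡ 3 * s′ + 5 * c′
  2s≡ = +-cancelʳ-≡ (4 * c′) _ _ (begin
    2 * s + 4 * c′           ≡⟨ solve (s ∷ c′ ∷ []) ⟩
    2 * (s + c′ * 2)         ≡⟨ cong (2 *_) s+2c′≡3c ⟩
    2 * (3 * c)              ≡⟨ solve (c ∷ []) ⟩
    3 * (2 * c)              ≡⟨ cong (3 *_) 3c′+s′≡2c ⟨
    3 * (3 * c′ + s′)        ≡⟨ solve (c′ ∷ s′ ∷ []) ⟩
    3 * s′ + 5 * c′ + 4 * c′ ∎)
    where open ≡-Reasoning
  c′<c : c′ < c
  c′<c = *-cancelʳ-< 2 c′ c (+-cancelˡ-< c _ _ (begin-strict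
    c + c′ * 2 <⟨ +-monoˡ-< (c′ * 2) c<s ⟩
    s + c′ * 2 ≡⟨ s+2c′≡3c ⟩
    3 * c      ≡⟨ solve (c ∷ []) ⟩
    c + c * 2  ∎))
    where open ≤-Reasoning

descent : ∀ {s c} → 1 ≤ c → Norm4 s c → ∃₂ λ s′ c′ → Step s′ c′ s c × c′ < c
descent {s} {c} c≥1 norm =
  s′ , c′ , step-down {s} {c} {s′} {c′} s+2c′≡3c 3c′+s′≡2c (Norm4-gap {s} {c} norm)
  where
  s+d≡3c : s + (3 * c ∸ s) ≡ 3 * c
  s+d≡3c = m+[n∸m]≡n (Norm4-upper {s} {c} c≥1 norm)
  2∣d : 2 ∣ 3 * c ∸ s
  2∣d = Norm4-parity {s} {c} s+d≡3c norm
  c′ : ℕ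
  c′ = quotient 2∣d
  s+2c′≡3c : s + c′ * 2 ≡ 3 * c
  s+2c′≡3c = trans (cong (_+_ s) (sym (_∣_.equality 2∣d))) s+d≡3c
  s′ : ℕ
  s′ = 2 * c ∸ 3 * c′
  3c′+s′≡2c : 3 * c′ + s′ ≡ 2 * c
  3c′+s′≡2c = m+[n∸m]≡n (step-down-bound {s} {c} {c′} s+2c′≡3c (Norm4-lower {s} {c} norm))

infixr 7 _⊙_
_⊙_ : ℤ → ℤ√5 → ℤ√5
k ⊙ (a , b) = (k ℤ.* a , k ℤ.* b)

U : ℤ√5
U = (+ 3 , + 1)

⊙-⊙ : ∀ k l p → k ⊙ (l ⊙ p) ≡ (k ℤ.* l) ⊙ p
⊙-⊙ k l (a , b) = cong₂ _,_ (sym (ℤ.*-assoc k l a)) (sym (ℤ.*-assoc k l b))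

⊙-· : ∀ k p q → k ⊙ (p · q) ≡ p · (k ⊙ q)
⊙-· k (a , b) (c , d) = cong₂ _,_ (real k a b c d) (irrational k a b c d)
  where
  real : ∀ k a b c d → k ℤ.* (a ℤ.* c ℤ.+ + 5 ℤ.* (b ℤ.* d)) ≡ a ℤ.* (k ℤ.* c) ℤ.+ + 5 ℤ.* (b ℤ.* (k ℤ.* d))
  real = ℤ-Ring.solve-∀
  irrational : ∀ k a b c d → k ℤ.* (a ℤ.* d ℤ.+ b ℤ.* c) ≡ a ℤ.* (k ℤ.* d) ℤ.+ b ℤ.* (k ℤ.* c)
  irrational = ℤ-Ring.solve-∀

·-swap : ∀ p q r → p · (q · r) ≡ q · (p · r)
·-swap (a , b) (c , d) (e , f) = cong₂ _,_ (real a b c d e f) (irrational a b c d e f)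
  where
  real : ∀ a b c d e f →
    a ℤ.* (c ℤ.* e ℤ.+ + 5 ℤ.* (d ℤ.* f)) ℤ.+ + 5 ℤ.* (b ℤ.* (c ℤ.* f ℤ.+ d ℤ.* e))
      ≡ c ℤ.* (a ℤ.* e ℤ.+ + 5 ℤ.* (b ℤ.* f)) ℤ.+ + 5 ℤ.* (d ℤ.* (a ℤ.* f ℤ.+ b ℤ.* e))
  real = ℤ-Ring.solve-∀
  irrational : ∀ a b c d e f →
    a ℤ.* (c ℤ.* f ℤ.+ d ℤ.* e) ℤ.+ b ℤ.* (c ℤ.* e ℤ.+ + 5 ℤ.* (d ℤ.* f))
      ≡ c ℤ.* (a ℤ.* f ℤ.+ b ℤ.* e) ℤ.+ d ℤ.* (a ℤ.* e ℤ.+ + 5 ℤ.* (b ℤ.* f))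
  irrational = ℤ-Ring.solve-∀

IsAB-suc : ∀ {i S C A B} → IsAB i A B → + 2 ⊙ (S , C) ≡ U · (A , B) → IsAB (suc i) S C
IsAB-suc {i} {S} {C} {A} {B} isAB doubled = begin
  + (2 ^ suc i) ⊙ (S , C)           ≡⟨ cong (_⊙ (S , C)) (ℤ.pos-* 2 (2 ^ i)) ⟩
  (+ 2 ℤ.* + (2 ^ i)) ⊙ (S , C)     ≡⟨ cong (_⊙ (S , C)) (ℤ.*-comm (+ 2) (+ (2 ^ i))) ⟩
  (+ (2 ^ i) ℤ.* + 2) ⊙ (S , C)     ≡⟨ ⊙-⊙ (+ (2 ^ i)) (+ 2) (S , C) ⟨
  + (2 ^ i) ⊙ (+ 2 ⊙ (S , C))       ≡⟨ cong (+ (2 ^ i) ⊙_) doubled ⟩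
  + (2 ^ i) ⊙ (U · (A , B))         ≡⟨ ⊙-· (+ (2 ^ i)) U (A , B) ⟩
  U · (+ (2 ^ i) ⊙ (A , B))         ≡⟨ cong (U ·_) isAB ⟩
  U · ((+ 2 , + 0) · (U ^√ i))      ≡⟨ ·-swap U (+ 2 , + 0) (U ^√ i) ⟩
  (+ 2 , + 0) · (U ^√ suc i)        ∎
  where open ≡-Reasoning

Step-in-ℤ√5 : ∀ {s′ c′ s c} → Step s′ c′ s c → + 2 ⊙ (+ s , + c) ≡ U · (+ s′ , + c′)
Step-in-ℤ√5 {s′} {c′} {s} {c} (2s≡ , 2c≡) = cong₂ _,_ real irrational
  where
  open ≡-Reasoning
  real : + 2 ℤ.* + s ≡ + 3 ℤ.* + s′ ℤ.+ + 5 ℤ.* (+ 1 ℤ.* + c′)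
  real = begin
    + 2 ℤ.* + s                         ≡⟨ ℤ.pos-* 2 s ⟨
    + (2 * s)                           ≡⟨ cong +_ 2s≡ ⟩
    + (3 * s′ + 5 * c′)                 ≡⟨ ℤ.pos-+ (3 * s′) (5 * c′) ⟩
    + (3 * s′) ℤ.+ + (5 * c′)           ≡⟨ cong₂ ℤ._+_ (ℤ.pos-* 3 s′) (ℤ.pos-* 5 c′) ⟩
    + 3 ℤ.* + s′ ℤ.+ + 5 ℤ.* + c′       ≡⟨ cong (λ t → + 3 ℤ.* + s′ ℤ.+ + 5 ℤ.* t) (ℤ.*-identityˡ (+ c′)) ⟨
    + 3 ℤ.* + s′ ℤ.+ + 5 ℤ.* (+ 1 ℤ.* + c′) ∎
  irrational : + 2 ℤ.* + c ≡ + 3 ℤ.* + c′ ℤ.+ + 1 ℤ.* + s′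
  irrational = begin
    + 2 ℤ.* + c                         ≡⟨ ℤ.pos-* 2 c ⟨
    + (2 * c)                           ≡⟨ cong +_ (trans 2c≡ (+-comm s′ (3 * c′))) ⟩
    + (3 * c′ + s′)                     ≡⟨ ℤ.pos-+ (3 * c′) s′ ⟩
    + (3 * c′) ℤ.+ + s′                 ≡⟨ cong₂ ℤ._+_ (ℤ.pos-* 3 c′) (sym (ℤ.*-identityˡ (+ s′))) ⟩
    + 3 ℤ.* + c′ ℤ.+ + 1 ℤ.* + s′       ∎

IsAB-zero : ∀ {A B} → IsAB 0 A B → B ≡ + 0
IsAB-zero {B = B} isAB = trans (sym (ℤ.*-identityˡ B)) (cong proj₂ isAB)

Norm4⇒IsAB : ∀ c s → Norm4 s c → ∃[ i ] IsAB i (+ s) (+ c)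
Norm4⇒IsAB = <-rec (λ c → ∀ s → Norm4 s c → ∃[ i ] IsAB i (+ s) (+ c)) induction
  where
  induction : ∀ c → (∀ {c′} → c′ < c → ∀ s′ → Norm4 s′ c′ → ∃[ i ] IsAB i (+ s′) (+ c′)) →
              ∀ s → Norm4 s c → ∃[ i ] IsAB i (+ s) (+ c)
  induction zero _ s norm rewrite square-root-unique {s} {2} norm = 0 , refl
  induction (suc c) smaller s norm =
    let s′ , c′ , step , c′<c = descent {s} {suc c} (s≤s z≤n) norm
        i , isAB = smaller c′<c s′ (Step-preserves-Norm4 {s′} {c′} {s} {suc c} step norm)
    in suc i , IsAB-suc {i} {+ s} {+ suc c} {+ s′} {+ c′} isAB
                 (Step-in-ℤ√5 {s′} {c′} {s} {suc c} step)

-- For c ≥ 1 the index is positive, since B_0 = 0.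
Norm4⇒IsAB⁺ : ∀ {s c} → 1 ≤ c → Norm4 s c → ∃[ i ] (1 ≤ i × IsAB i (+ s) (+ c))
Norm4⇒IsAB⁺ {s} {c} c≥1 norm with Norm4⇒IsAB c s norm
... | zero , isAB = contradiction (ℤ.+-injective (IsAB-zero isAB)) (≢-sym (<⇒≢ c≥1))
... | suc i , isAB = suc i , s≤s z≤n , isAB

arithmetic-half : ∀ {u s c} → 1 ≤ c → s * s + 1 ≡ 5 * u → c * c + 1 ≡ u →
  ∃[ i ] (1 ≤ i × Σ[ A ∈ ℤ ] Σ[ B ∈ ℤ ] (IsAB i A B × + u ≡ B ℤ.* B ℤ.+ + 1))
arithmetic-half {u} {s} {c} c≥1 s²+1≡5u c²+1≡u with Norm4⇒IsAB⁺ c≥1 norm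
  where
  norm : Norm4 s c
  norm = +-cancelʳ-≡ 1 _ _ (trans s²+1≡5u (trans (cong (5 *_) (sym c²+1≡u)) (solve (c ∷ []))))
... | i , i≥1 , isAB = i , i≥1 , + s , + c , isAB , u≡c²+1
  where
  u≡c²+1 : + u ≡ + c ℤ.* + c ℤ.+ + 1
  u≡c²+1 = trans (cong +_ (sym c²+1≡u)) (trans (ℤ.pos-+ (c * c) 1) (cong (ℤ._+ + 1) (ℤ.pos-* c c)))

lemma5p1 : (u : ℕ) → 1 ≤ u →
    (s k l : ℕ) → s * s + 1 ≡ 5 * u → k + s ≡ 2 * u → l + s ≡ u + 1 →
    1 ≤ k →
    (∃[ D ] IsCyclicDifferenceSet (4 * u) k l D) →
    ∃[ i ] (1 ≤ i × Σ[ A ∈ ℤ ] Σ[ B ∈ ℤ ] (IsAB i A B × + u ≡ B ℤ.* B ℤ.+ + 1))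
lemma5p1 u _ s k l s²+1≡5u k+s≡2u l+s≡u+1 k≥1 differenceSet =
  arithmetic-half {u} {s} {c} c≥1 s²+1≡5u c²+1≡u
  where
  4u≡2u+2u : 4 * u ≡ 2 * u + 2 * u
  4u≡2u+2u = solve (u ∷ [])
  relation : ∃[ c ] c * c + 2 * (2 * u * l) ≡ k * k
  relation = square-relation (2 * u)
    (proj₂ (subst (λ n → ∃[ D ] IsCyclicDifferenceSet n k l D) 4u≡2u+2u differenceSet))
  c : ℕ
  c = proj₁ relation
  c²+1≡u : c * c + 1 ≡ u
  c²+1≡u = parameters⇒square {u} {s} {k} {l} {c} s²+1≡5u k+s≡2u l+s≡u+1 (proj₂ relation)
  c≥1 : 1 ≤ c
  c≥1 = n≢0⇒n>0 (λ c≡0 → <⇒≢ k≥1 (sym (u≡1⇒k≡0 {u} {s} {k} s²+1≡5u k+s≡2u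
          (trans (sym c²+1≡u) (cong (λ t → t * t + 1) c≡0)))))
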